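{- Let $n$ be an even positive integer and let $G$ be the $2$-dimensional $n\times n$ grid graph with vertex set $V=[n]^2$. Then the maximum size of a subset $S\subseteq V$ such that the induced subgraph $G_S$ contains no $4$-cycle is $3(n/2)^2$.
   Context: The $2$-dimensional grid graph has vertex set $[n]^2=\{1,\dots,n\}^2$, with $(x,y)$ adjacent to $(z,w)$ if and only if $|x-z|+|y-w|=1$. For $S\subseteq V$, the induced subgraph $G_S$ has vertex set $S$, and $uv$ is an edge of $G_S$ iff $u,v\in S$ and $uv$ is an edge of $G$. $G_S$ is called $4$-cycle-free if it contains no cycle of length $4$. -}

module Defs where

open import Data.Nat using (ℕ; _+_; ∣_-_∣)
open import Data.Fin using (Fin; toℕ)
open import Data.Bool using (Bool; true; false; if_then_else_)
open import Data.Product using (_×_; _,_; Σ; ∃)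
open import Data.List using (List; map; allFin)
open import Data.Nat.ListAction using (sum)
open import Data.Empty using (⊥)
open import Relation.Binary.PropositionalEquality using (_≡_; _≢_)

-- Vertices of the n × n grid graph: [n]^2, encoded as Fin n × Fin n
-- (coordinate i ∈ Fin n stands for i+1 ∈ [n]).
Vertex : ℕ → Set
Vertex n = Fin n × Fin n

Adj : ∀ {n} → Vertex n → Vertex n → Set
Adj (x , y) (z , w) = ∣ toℕ x - toℕ z ∣ + ∣ toℕ y - toℕ w ∣ ≡ 1

VSubset : ℕ → Set
VSubset n = Vertex n → Bool

_∈S_ : ∀ {n} → Vertex n → VSubset n → Set
v ∈S S = S v ≡ true

card : ∀ {n} → VSubset n → ℕ
card {n} S = sum (map (λ i → sum (map (λ j → if S (i , j) then 1 else 0) (allFin n))) (allFin n))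

record FourCycle {n : ℕ} (S : VSubset n) : Set where
  field
    a b c d : Vertex n
    a∈ : a ∈S S
    b∈ : b ∈S S
    c∈ : c ∈S S
    d∈ : d ∈S S
    a≢b : a ≢ b
    a≢c : a ≢ c
    a≢d : a ≢ d
    b≢c : b ≢ c
    b≢d : b ≢ d
    c≢d : c ≢ d
    ab : Adj a b
    bc : Adj b c
    cd : Adj c d
    da : Adj d a

FourCycleFree : ∀ {n} → VSubset n → Set
FourCycleFree S = FourCycle S → ⊥

module Submission where

-- Lower bound: S = {(x, y) : x or y even} has 3k² points. Call a point of S a corner if both its
-- coordinates are even. Corners and non-corners alternate along the edges of G_S, and a non-corner
-- has its neighbours in S on one line, so it is the midpoint of any two distinct ones. In a 4-cycle
-- of G_S two opposite vertices are non-corners with the same two neighbours, hence they coincide.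
-- Upper bound: the grid splits into k² disjoint unit squares; each is a 4-cycle of G, so it meets
-- a 4-cycle-free S in at most 3 points.

open import Defs
open import Data.Nat using (ℕ; zero; suc; _*_; _+_; _≤_; _<_; z≤n; s≤s; ∣_-_∣)
open import Data.Nat.Properties
  using (+-assoc; +-identityʳ; +-comm; suc-injective; +-mono-≤; ≤-refl; <⇒≢; n<1+n; ∣m-n∣≡0⇒m≡n; ∣n-n∣≡0; ∣m-m+n∣≡n; ∣-∣-comm;
         *-cancelˡ-≡; +-0-commutativeMonoid; module ≤-Reasoning)
open import Data.Nat.Tactic.RingSolver using (solve-∀)
open import Data.Nat.ListAction as List using ()
open import Algebra.Properties.CommutativeMonoid.Sum +-0-commutativeMonoid
  using (sum; sum-syntax; sum-cong-≗; ∑-distrib-+)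
open import Data.Fin using (Fin; toℕ) renaming (zero to fzero; suc to fsuc)
open import Data.Fin.Properties using (toℕ-injective)
open import Data.Bool using (Bool; true; false; not; _∨_; _∧_; if_then_else_)
open import Data.Bool.Properties using (not-involutive)
open import Data.Product using (_×_; Σ; _,_; proj₁; proj₂)
open import Data.Sum using (_⊎_; inj₁; inj₂)
open import Data.Empty using (⊥; ⊥-elim)
open import Data.List using (map; tabulate)
open import Function using (_∘_; id)
open import Relation.Binary.PropositionalEquality
  using (_≡_; _≢_; refl; sym; trans; cong; cong₂; subst; module ≡-Reasoning)

even : ℕ → Bool
even zero = true
even (suc zero) = false
even (suc (suc n)) = even n

even-suc : ∀ n → even (suc n) ≡ not (even n)
even-suc zero = refl
even-suc (suc zero) = refl
even-suc (suc (suc n)) = even-suc n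

∣m-n∣≡1⇒m≡1+n∨n≡1+m : ∀ m n → ∣ m - n ∣ ≡ 1 → m ≡ suc n ⊎ n ≡ suc m
∣m-n∣≡1⇒m≡1+n∨n≡1+m zero (suc zero) _ = inj₂ refl
∣m-n∣≡1⇒m≡1+n∨n≡1+m (suc zero) zero _ = inj₁ refl
∣m-n∣≡1⇒m≡1+n∨n≡1+m (suc m) (suc n) e with ∣m-n∣≡1⇒m≡1+n∨n≡1+m m n e
... | inj₁ m≡1+n = inj₁ (cong suc m≡1+n)
... | inj₂ n≡1+m = inj₂ (cong suc n≡1+m)

∣m-1+m∣≡1 : ∀ m → ∣ m - suc m ∣ ≡ 1
∣m-1+m∣≡1 m = subst (λ k → ∣ m - k ∣ ≡ 1) (+-comm m 1) (∣m-m+n∣≡n m 1)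

∣m-n∣≡1⇒even-n≡not-even-m : ∀ m n → ∣ m - n ∣ ≡ 1 → even n ≡ not (even m)
∣m-n∣≡1⇒even-n≡not-even-m m n e with ∣m-n∣≡1⇒m≡1+n∨n≡1+m m n e
... | inj₁ refl = trans (sym (not-involutive (even n))) (cong not (sym (even-suc n)))
... | inj₂ refl = even-suc m

∣m-p∣≡1⇒∣m-q∣≡1⇒p+q≡2*m : ∀ m {p q} → ∣ m - p ∣ ≡ 1 → ∣ m - q ∣ ≡ 1 → p ≢ q → p + q ≡ 2 * m
∣m-p∣≡1⇒∣m-q∣≡1⇒p+q≡2*m m {p} {q} mp mq p≢q
  with ∣m-n∣≡1⇒m≡1+n∨n≡1+m m p mp | ∣m-n∣≡1⇒m≡1+n∨n≡1+m m q mq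
... | inj₁ refl | inj₁ m≡1+q = ⊥-elim (p≢q (suc-injective m≡1+q))
... | inj₂ refl | inj₂ refl = ⊥-elim (p≢q refl)
... | inj₁ refl | inj₂ refl = lower+upper p
  where
  lower+upper : ∀ k → k + suc (suc k) ≡ 2 * suc k
  lower+upper = solve-∀
... | inj₂ refl | inj₁ refl = upper+lower q
  where
  upper+lower : ∀ k → suc (suc k) + k ≡ 2 * suc k
  upper+lower = solve-∀

m+m≡2*m : ∀ m → m + m ≡ 2 * m
m+m≡2*m m = cong (m +_) (sym (+-identityʳ m))

m+n≡1⇒[m≡1∧n≡0]∨[m≡0∧n≡1] : ∀ m {n} → m + n ≡ 1 → (m ≡ 1 × n ≡ 0) ⊎ (m ≡ 0 × n ≡ 1)
m+n≡1⇒[m≡1∧n≡0]∨[m≡0∧n≡1] zero e = inj₂ (refl , e)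
m+n≡1⇒[m≡1∧n≡0]∨[m≡0∧n≡1] (suc zero) e = inj₁ (refl , suc-injective e)

Point : Set
Point = ℕ × ℕ

_~_ : Point → Point → Set
(x , y) ~ (z , w) = ∣ x - z ∣ + ∣ y - w ∣ ≡ 1

~-sym : ∀ u v → u ~ v → v ~ u
~-sym (x , y) (z , w) rewrite ∣-∣-comm z x | ∣-∣-comm w y = id

~⇒unit-step : ∀ x y z w → (x , y) ~ (z , w) → (∣ x - z ∣ ≡ 1 × y ≡ w) ⊎ (x ≡ z × ∣ y - w ∣ ≡ 1)
~⇒unit-step x y z w e with m+n≡1⇒[m≡1∧n≡0]∨[m≡0∧n≡1] ∣ x - z ∣ e
... | inj₁ (x~z , y≡w) = inj₁ (x~z , ∣m-n∣≡0⇒m≡n y≡w)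
... | inj₂ (x≡z , y~w) = inj₂ (∣m-n∣≡0⇒m≡n x≡z , y~w)

evenCoordinate : Point → Bool
evenCoordinate (x , y) = even x ∨ even y

corner : Point → Bool
corner (x , y) = even x ∧ even y

corner-alternates : ∀ u v → evenCoordinate u ≡ true → evenCoordinate v ≡ true → u ~ v →
                      corner v ≡ not (corner u)
corner-alternates (x , y) (z , w) u∈ v∈ u~v with ~⇒unit-step x y z w u~v
... | inj₁ (x~z , refl) rewrite ∣m-n∣≡1⇒even-n≡not-even-m x z x~z = flipˡ (even x) (even y) u∈ v∈
  where
  flipˡ : ∀ a b → a ∨ b ≡ true → not a ∨ b ≡ true → not a ∧ b ≡ not (a ∧ b)
  flipˡ true true _ _ = refl
  flipˡ false true _ _ = refl
  flipˡ true false _ ()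
  flipˡ false false () _
... | inj₂ (refl , y~w) rewrite ∣m-n∣≡1⇒even-n≡not-even-m y w y~w = flipʳ (even x) (even y) u∈ v∈
  where
  flipʳ : ∀ a b → a ∨ b ≡ true → a ∨ not b ≡ true → a ∧ not b ≡ not (a ∧ b)
  flipʳ true true _ _ = refl
  flipʳ true false _ _ = refl
  flipʳ false true _ ()
  flipʳ false false () _

Axis : Bool → Point → Point → Set
Axis false (x , y) (z , w) = ∣ x - z ∣ ≡ 1 × y ≡ w
Axis true  (x , y) (z , w) = x ≡ z × ∣ y - w ∣ ≡ 1

-- A non-corner has exactly one odd coordinate, and only that coordinate can change along an edge of
-- G_S; the index of Axis (false: first coordinate changes, true: second) is the parity of x.
nonCorner-neighbour : ∀ w p → evenCoordinate w ≡ true → corner w ≡ false → evenCoordinate p ≡ true →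
                      w ~ p → Axis (even (proj₁ w)) w p
nonCorner-neighbour (x , y) (z , v) w∈ w-noncorner p∈ w~p with ~⇒unit-step x y z v w~p
... | inj₁ (x~z , refl) = subst (λ b → Axis b (x , y) (z , y))
  (sym (x-odd (even x) (even y) (∣m-n∣≡1⇒even-n≡not-even-m x z x~z) w-noncorner p∈)) (x~z , refl)
  where
  x-odd : ∀ a b {c} → c ≡ not a → a ∧ b ≡ false → c ∨ b ≡ true → a ≡ false
  x-odd true true _ () _
  x-odd true false refl _ ()
  x-odd false _ _ _ _ = refl
... | inj₂ (refl , y~v) = subst (λ b → Axis b (x , y) (x , v))
  (sym (x-even (even x) (even y) (∣m-n∣≡1⇒even-n≡not-even-m y v y~v) w∈ w-noncorner p∈)) (refl , y~v)
  where
  x-even : ∀ a b {c} → c ≡ not b → a ∨ b ≡ true → a ∧ b ≡ false → a ∨ c ≡ true → a ≡ true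
  x-even false true refl _ _ ()
  x-even false false _ () _ _
  x-even true _ _ _ _ _ = refl

data IsMidpoint : Point → Point → Point → Set where
  midpoint : ∀ {x y px py qx qy} → px + qx ≡ 2 * x → py + qy ≡ 2 * y → IsMidpoint (x , y) (px , py) (qx , qy)

IsMidpoint-unique : ∀ {w w' p q} → IsMidpoint w p q → IsMidpoint w' p q → w ≡ w'
IsMidpoint-unique {x , y} {x' , y'} (midpoint px+qx py+qy) (midpoint px+qx' py+qy') =
  cong₂ _,_ (*-cancelˡ-≡ x x' 2 (trans (sym px+qx) px+qx')) (*-cancelˡ-≡ y y' 2 (trans (sym py+qy) py+qy'))

nonCorner-midpoint : ∀ w p q → evenCoordinate w ≡ true → corner w ≡ false →
                     evenCoordinate p ≡ true → evenCoordinate q ≡ true → w ~ p → w ~ q → p ≢ q → IsMidpoint w p q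
nonCorner-midpoint (x , y) p q w∈ w-noncorner p∈ q∈ w~p w~q p≢q
  with even x | nonCorner-neighbour (x , y) p w∈ w-noncorner p∈ w~p | nonCorner-neighbour (x , y) q w∈ w-noncorner q∈ w~q
... | false | x~px , refl | x~qx , refl =
  midpoint (∣m-p∣≡1⇒∣m-q∣≡1⇒p+q≡2*m x x~px x~qx (λ px≡qx → p≢q (cong₂ _,_ px≡qx refl))) (m+m≡2*m y)
... | true | refl , y~py | refl , y~qy =
  midpoint (m+m≡2*m x) (∣m-p∣≡1⇒∣m-q∣≡1⇒p+q≡2*m y y~py y~qy (λ py≡qy → p≢q (cong₂ _,_ refl py≡qy)))

evenCoordinate-4-cycle-free : ∀ a b c d →
  evenCoordinate a ≡ true → evenCoordinate b ≡ true → evenCoordinate c ≡ true → evenCoordinate d ≡ true →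
  a ~ b → b ~ c → c ~ d → d ~ a → a ≢ c → b ≢ d → ⊥
evenCoordinate-4-cycle-free a b c d a∈ b∈ c∈ d∈ a~b b~c c~d d~a a≢c b≢d with corner a in corner-a
... | true = b≢d (IsMidpoint-unique (nonCorner-midpoint b a c b∈ b-noncorner a∈ c∈ (~-sym a b a~b) b~c a≢c)
                                    (nonCorner-midpoint d a c d∈ d-noncorner a∈ c∈ d~a (~-sym c d c~d) a≢c))
  where
  b-noncorner : corner b ≡ false
  b-noncorner = trans (corner-alternates a b a∈ b∈ a~b) (cong not corner-a)
  d-noncorner : corner d ≡ false
  d-noncorner = trans (corner-alternates a d a∈ d∈ (~-sym d a d~a)) (cong not corner-a)
... | false = a≢c (IsMidpoint-unique (nonCorner-midpoint a b d a∈ corner-a b∈ d∈ a~b (~-sym d a d~a) b≢d)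
                                     (nonCorner-midpoint c b d c∈ c-noncorner b∈ d∈ (~-sym b c b~c) c~d b≢d))
  where
  b-corner : corner b ≡ true
  b-corner = trans (corner-alternates a b a∈ b∈ a~b) (cong not corner-a)
  c-noncorner : corner c ≡ false
  c-noncorner = trans (corner-alternates b c b∈ c∈ b~c) (cong not b-corner)

point : ∀ {n} → Vertex n → Point
point (i , j) = toℕ i , toℕ j

point-injective : ∀ {n} {u v : Vertex n} → point u ≡ point v → u ≡ v
point-injective eq = cong₂ _,_ (toℕ-injective (cong proj₁ eq)) (toℕ-injective (cong proj₂ eq))

stripes : ∀ {n} → VSubset n
stripes v = evenCoordinate (point v)

stripes-4-cycle-free : ∀ {n} → FourCycleFree (stripes {n})
stripes-4-cycle-free cycle = evenCoordinate-4-cycle-free (point a) (point b) (point c) (point d)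
  a∈ b∈ c∈ d∈ ab bc cd da (a≢c ∘ point-injective) (b≢d ∘ point-injective)
  where open FourCycle cycle

𝟙 : Bool → ℕ
𝟙 b = if b then 1 else 0

sum-map-tabulate : ∀ {A : Set} {n} (f : A → ℕ) (g : Fin n → A) → List.sum (map f (tabulate g)) ≡ ∑[ i < n ] f (g i)
sum-map-tabulate {n = zero} f g = refl
sum-map-tabulate {n = suc n} f g = cong (f (g fzero) +_) (sum-map-tabulate f (g ∘ fsuc))

card≡∑∑ : ∀ {n} (S : VSubset n) → card S ≡ ∑[ i < n ] ∑[ j < n ] 𝟙 (S (i , j))
card≡∑∑ {n} S = trans (sum-map-tabulate {n = n} _ id) (sum-cong-≗ {n} λ i → sum-map-tabulate {n = n} _ id)

-- Unlike 2 * m, double (suc m) reduces to suc (suc (double m)), so sums over Fin (double m)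
-- unfold two terms at a time.
double : ℕ → ℕ
double zero = zero
double (suc m) = suc (suc (double m))

double≡2* : ∀ m → double m ≡ 2 * m
double≡2* zero = refl
double≡2* (suc m) = trans (cong (suc ∘ suc) (double≡2* m)) (2+2*m≡2*[1+m] m)
  where
  2+2*m≡2*[1+m] : ∀ m → suc (suc (2 * m)) ≡ 2 * suc m
  2+2*m≡2*[1+m] = solve-∀

∑1≡n : ∀ n → ∑[ i < n ] 1 ≡ n
∑1≡n zero = refl
∑1≡n (suc n) = cong suc (∑1≡n n)

∑-even≡half : ∀ m → ∑[ j < double m ] 𝟙 (even (toℕ j)) ≡ m
∑-even≡half zero = refl
∑-even≡half (suc m) = cong suc (∑-even≡half m)

∑-alternating : ∀ m A B → ∑[ i < double m ] (if even (toℕ i) then A else B) ≡ m * (A + B)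
∑-alternating zero A B = refl
∑-alternating (suc m) A B = trans (sym (+-assoc A B _)) (cong ((A + B) +_) (∑-alternating m A B))

row-count : ∀ m b → ∑[ j < double m ] 𝟙 (b ∨ even (toℕ j)) ≡ (if b then double m else m)
row-count m true = ∑1≡n (double m)
row-count m false = ∑-even≡half m

card-stripes≡3k² : ∀ k → card (stripes {double k}) ≡ 3 * (k * k)
card-stripes≡3k² k = begin
  card (stripes {double k})
    ≡⟨ card≡∑∑ (stripes {double k}) ⟩
  ∑[ i < double k ] ∑[ j < double k ] 𝟙 (even (toℕ i) ∨ even (toℕ j))
    ≡⟨ sum-cong-≗ {double k} (λ i → row-count k (even (toℕ i))) ⟩
  ∑[ i < double k ] (if even (toℕ i) then double k else k)
    ≡⟨ ∑-alternating k (double k) k ⟩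
  k * (double k + k)
    ≡⟨ cong (λ d → k * (d + k)) (double≡2* k) ⟩
  k * (2 * k + k)
    ≡⟨ k*[2k+k]≡3*[k*k] k ⟩
  3 * (k * k)
    ∎
  where
  open ≡-Reasoning
  k*[2k+k]≡3*[k*k] : ∀ k → k * (2 * k + k) ≡ 3 * (k * k)
  k*[2k+k]≡3*[k*k] = solve-∀

Consecutive : ∀ {n} → Fin n → Fin n → Set
Consecutive i i' = toℕ i' ≡ suc (toℕ i)

Consecutive⇒≢ : ∀ {n} {i i' : Fin n} → Consecutive i i' → i ≢ i'
Consecutive⇒≢ {i = i} ii' i≡i' = <⇒≢ (n<1+n (toℕ i)) (trans (cong toℕ i≡i') ii')

∑-pairs-≤ : ∀ m {B} (f : Fin (double m) → ℕ) → (∀ i i' → Consecutive i i' → f i + f i' ≤ B) →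
            ∑[ i < double m ] f i ≤ m * B
∑-pairs-≤ zero f _ = z≤n
∑-pairs-≤ (suc m) {B} f pair≤B = begin
  f fzero + (f (fsuc fzero) + ∑[ i < double m ] f (fsuc (fsuc i))) ≡⟨ +-assoc (f fzero) _ _ ⟨
  (f fzero + f (fsuc fzero)) + ∑[ i < double m ] f (fsuc (fsuc i)) ≤⟨ +-mono-≤ (pair≤B fzero (fsuc fzero) refl)
                                                                      (∑-pairs-≤ m (f ∘ fsuc ∘ fsuc) pair≤B') ⟩
  B + m * B                                                         ∎
  where
  open ≤-Reasoning
  pair≤B' : ∀ i i' → Consecutive i i' → f (fsuc (fsuc i)) + f (fsuc (fsuc i')) ≤ B
  pair≤B' i i' ii' = pair≤B (fsuc (fsuc i)) (fsuc (fsuc i')) (cong (suc ∘ suc) ii')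

𝟙≤1 : ∀ b → 𝟙 b ≤ 1
𝟙≤1 true = ≤-refl
𝟙≤1 false = z≤n

𝟙-sum≤3 : ∀ a b c d → (a ≡ true → b ≡ true → c ≡ true → d ≡ true → ⊥) → (𝟙 a + 𝟙 b) + (𝟙 c + 𝟙 d) ≤ 3
𝟙-sum≤3 true true true true not-all = ⊥-elim (not-all refl refl refl refl)
𝟙-sum≤3 false b c d _ = +-mono-≤ (𝟙≤1 b) (+-mono-≤ (𝟙≤1 c) (𝟙≤1 d))
𝟙-sum≤3 true false c d _ = s≤s (+-mono-≤ (𝟙≤1 c) (𝟙≤1 d))
𝟙-sum≤3 true true false d _ = s≤s (s≤s (𝟙≤1 d))
𝟙-sum≤3 true true true false _ = ≤-refl

~-right : ∀ x y → (x , y) ~ (suc x , y)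
~-right x y = cong₂ _+_ (∣m-1+m∣≡1 x) (∣n-n∣≡0 y)

~-up : ∀ x y → (x , y) ~ (x , suc y)
~-up x y = cong₂ _+_ (∣n-n∣≡0 x) (∣m-1+m∣≡1 y)

Consecutive⇒Adj₁ : ∀ {n} {i i' : Fin n} j → Consecutive i i' → Adj (i , j) (i' , j)
Consecutive⇒Adj₁ {i = i} j ii' rewrite ii' = ~-right (toℕ i) (toℕ j)

Consecutive⇒Adj₂ : ∀ {n} i {j j' : Fin n} → Consecutive j j' → Adj (i , j) (i , j')
Consecutive⇒Adj₂ i {j} jj' rewrite jj' = ~-up (toℕ i) (toℕ j)

unitSquare : ∀ {n} (S : VSubset n) {i i' j j'} → Consecutive i i' → Consecutive j j' →
             (i , j) ∈S S → (i' , j) ∈S S → (i' , j') ∈S S → (i , j') ∈S S → FourCycle S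
unitSquare S {i} {i'} {j} {j'} ii' jj' a∈ b∈ c∈ d∈ = record
  { a = i , j ; b = i' , j ; c = i' , j' ; d = i , j'
  ; a∈ = a∈ ; b∈ = b∈ ; c∈ = c∈ ; d∈ = d∈
  ; a≢b = i≢i' ∘ cong proj₁ ; a≢c = i≢i' ∘ cong proj₁ ; a≢d = j≢j' ∘ cong proj₂
  ; b≢c = j≢j' ∘ cong proj₂ ; b≢d = i≢i' ∘ sym ∘ cong proj₁ ; c≢d = i≢i' ∘ sym ∘ cong proj₁
  ; ab = Consecutive⇒Adj₁ j ii'
  ; bc = Consecutive⇒Adj₂ i' jj'
  ; cd = ~-sym (toℕ i , toℕ j') (toℕ i' , toℕ j') (Consecutive⇒Adj₁ j' ii')
  ; da = ~-sym (toℕ i , toℕ j) (toℕ i , toℕ j') (Consecutive⇒Adj₂ i jj')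
  }
  where
  i≢i' = Consecutive⇒≢ ii'
  j≢j' = Consecutive⇒≢ jj'

unitSquare-≤3 : ∀ {n} (S : VSubset n) → FourCycleFree S → ∀ {i i' j j'} → Consecutive i i' → Consecutive j j' →
                (𝟙 (S (i , j)) + 𝟙 (S (i' , j))) + (𝟙 (S (i , j')) + 𝟙 (S (i' , j'))) ≤ 3
unitSquare-≤3 S free ii' jj' = 𝟙-sum≤3 _ _ _ _ λ a∈ b∈ d∈ c∈ → free (unitSquare S ii' jj' a∈ b∈ c∈ d∈)

FourCycleFree⇒card≤3k² : ∀ k (S : VSubset (double k)) → FourCycleFree S → card S ≤ 3 * (k * k)
FourCycleFree⇒card≤3k² k S free = begin
  card S                                                  ≡⟨ card≡∑∑ S ⟩
  ∑[ i < double k ] ∑[ j < double k ] 𝟙 (S (i , j))       ≤⟨ ∑-pairs-≤ k _ row-pair≤ ⟩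
  k * (k * 3)                                             ≡⟨ k*[k*3]≡3*[k*k] k ⟩
  3 * (k * k)                                             ∎
  where
  open ≤-Reasoning
  row-pair≤ : ∀ i i' → Consecutive i i' → ∑[ j < double k ] 𝟙 (S (i , j)) + ∑[ j < double k ] 𝟙 (S (i' , j)) ≤ k * 3
  row-pair≤ i i' ii' = begin
    ∑[ j < double k ] 𝟙 (S (i , j)) + ∑[ j < double k ] 𝟙 (S (i' , j)) ≡⟨ ∑-distrib-+ {double k} _ _ ⟨
    ∑[ j < double k ] (𝟙 (S (i , j)) + 𝟙 (S (i' , j)))                  ≤⟨ ∑-pairs-≤ k _ (λ j j' jj' → unitSquare-≤3 S free ii' jj') ⟩
    k * 3                                                               ∎
  k*[k*3]≡3*[k*k] : ∀ k → k * (k * 3) ≡ 3 * (k * k)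
  k*[k*3]≡3*[k*k] = solve-∀

lemma1p3 : (n k : ℕ) → n ≡ 2 * k → 0 < k →
    (Σ (VSubset n) (λ S → FourCycleFree S × card S ≡ 3 * (k * k)))
    × ((S : VSubset n) → FourCycleFree S → card S ≤ 3 * (k * k))
lemma1p3 n k n≡2k _ rewrite n≡2k | sym (double≡2* k) =
  (stripes , stripes-4-cycle-free , card-stripes≡3k² k) , FourCycleFree⇒card≤3k² k
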